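{- Let $H=(V,\Delta)$ be a 3-graph such that $|V|$ is odd and every pair of distinct vertices is contained in at least one triple of $H$. Then $H$ has a spanning tree.
   Context: A 3-graph is $H=(V,\Delta)$ with $V$ finite and $\Delta\subseteq\binom V3$ (triples). A cycle in $H$ is a sequence $a_0,t_1,a_1,\dots,a_{\ell-1},t_\ell,a_\ell=a_0$ with $\ell\ge2$, $a_0,\dots,a_{\ell-1}$ distinct vertices, $t_1,\dots,t_\ell$ distinct triples, and $a_{i-1},a_i\in t_i$. A spanning tree is a set $T\subseteq\Delta$ containing no cycle, with $\bigcup T=V$, such that any two vertices are joined by a path $a_0,t_1,a_1,\dots,t_\ell,a_\ell$ of distinct vertices and distinct triples of $T$ with $a_{i-1},a_i\in t_i$. -}

module Defs where

open import Data.Nat using (ℕ; suc; _≤_; _*_; _+_)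
open import Data.Fin using (Fin; zero; suc; inject₁; fromℕ)
open import Data.Fin.Subset using (Subset; _∈_; ∣_∣)
open import Data.Product using (Σ; ∃; ∃-syntax; _×_)
open import Relation.Binary.PropositionalEquality using (_≡_; _≢_)
open import Data.Empty using (⊥)
open import Function.Definitions using (Injective)

record ThreeGraph (n : ℕ) : Set where
  field
    m       : ℕ
    Δ       : Fin m → Subset n
    size3   : ∀ i → ∣ Δ i ∣ ≡ 3
    distinct : Injective _≡_ _≡_ Δ
open ThreeGraph public

-- A set of triples T ⊆ Δ is a subset of the index set Fin m.
TripleSet : ∀ {n} → ThreeGraph n → Set
TripleSet H = Subset (m H)

-- A walk shape of length ℓ inside T: vertices a₀,…,a_ℓ and triples
-- t₁,…,t_ℓ (here indexed t 0 … t (ℓ-1)) with distinct triples, all in T,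
-- and a_{i-1}, a_i ∈ t_i.
record Linked {n} (H : ThreeGraph n) (T : TripleSet H) (ℓ : ℕ) : Set where
  field
    a      : Fin (suc ℓ) → Fin n
    t      : Fin ℓ → Fin (m H)
    t-inj  : Injective _≡_ _≡_ t
    t-in-T : ∀ i → t i ∈ T
    left   : ∀ i → a (inject₁ i) ∈ Δ H (t i)
    right  : ∀ i → a (suc i) ∈ Δ H (t i)
open Linked public

record Cycle {n} (H : ThreeGraph n) (T : TripleSet H) : Set where
  field
    ℓ      : ℕ
    ℓ≥2    : 2 ≤ ℓ
    walk   : Linked H T ℓ
    closed : a walk (fromℕ ℓ) ≡ a walk zero
    a-inj  : Injective _≡_ _≡_ (λ (i : Fin ℓ) → a walk (inject₁ i))

record Path {n} (H : ThreeGraph n) (T : TripleSet H) (x y : Fin n) : Set where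
  field
    ℓ     : ℕ
    walk  : Linked H T ℓ
    a-inj : Injective _≡_ _≡_ (a walk)
    start : a walk zero ≡ x
    end   : a walk (fromℕ ℓ) ≡ y

record IsSpanningTree {n} (H : ThreeGraph n) (T : TripleSet H) : Set where
  field
    acyclic    : Cycle H T → ⊥
    covers     : ∀ (v : Fin n) → ∃[ i ] (i ∈ T × v ∈ Δ H i)
    connected  : ∀ (x y : Fin n) → Path H T x y

Odd : ℕ → Set
Odd n = ∃[ k ] (n ≡ 2 * k + 1)

PairCovering : ∀ {n} → ThreeGraph n → Set
PairCovering {n} H = ∀ (u v : Fin n) → u ≢ v → ∃[ i ] (u ∈ Δ H i × v ∈ Δ H i)

module Submission where

-- A tree with k triples covers exactly 2k + 1 vertices, so when n is odd a tree
-- that misses some vertex misses two of them, w and w′, and it suffices to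
-- enlarge it by one triple.  Let z complete the triple through the root q and w.
-- If z is not covered, that triple is a new leaf.  Otherwise z lies in the branch
-- below some triple t = {q, y, y′}, say below y.  Exchanging t for {q, z, w}
-- gives a tree X covering everything except the branch Y′ at y′.  Let z′
-- complete the triple through y′ and w′: if z′ ∈ X, hang Y′ from X by it; if
-- z′ ∉ X ∪ Y′, it is a new leaf at y′ of the old tree; if z′ ∈ Y′, repeat the
-- argument at y′ inside the strictly smaller Y′, with w and w′ exchanged.
-- The triples of a tree can be peeled off one by one, each meeting the later
-- ones in at most one vertex, and this rules out cycles.

open import Defs

open import Data.Empty using (⊥; ⊥-elim)
open import Data.Fin using (Fin; zero; suc; inject₁; fromℕ) renaming (_≟_ to _≟ᶠ_)
import Data.Fin.Properties as Fin
open import Data.Fin.Subset using (Subset; inside; outside; ∣_∣; ⋃; ⁅_⁆) renaming (_∈_ to _∈ₛ_)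
open import Data.Fin.Subset.Properties using (x∈p∪q⁺; x∈p∪q⁻; x∈⁅x⁆; x∈⁅y⁆⇒x≡y; ∉⊥) renaming (_∈?_ to _∈ₛ?_)
open import Data.List using (List; []; _∷_; [_]; length; map; _++_; allFin)
open import Data.List.Properties using (length-map; length-removeAt′; length-tabulate; length-++)
open import Data.List.Membership.Propositional using (_∈_; _∉_; _─_)
open import Data.List.Membership.Propositional.Properties using (∈-map⁺; ∈-map⁻; ∈-allFin; ∈-++⁺ˡ; ∈-++⁺ʳ; ∈-++⁻)
import Data.List.Membership.DecPropositional as DecMembership
open import Data.List.Relation.Binary.Disjoint.Propositional using (Disjoint)
open import Data.List.Relation.Binary.Subset.Propositional using (_⊆_)
open import Data.List.Relation.Unary.All using ([]; _∷_)
import Data.List.Relation.Unary.All as All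
open import Data.List.Relation.Unary.AllPairs using ([]; _∷_)
open import Data.List.Relation.Unary.Any using (here; there; index)
open import Data.List.Relation.Unary.Unique.Propositional using (Unique)
import Data.List.Relation.Unary.Unique.Propositional.Properties as Unique
open import Data.Nat using (ℕ; zero; suc; _+_; _*_; _<_; _≤_; s≤s; z≤n)
open import Data.Nat.Properties
  using (≤⇒≯; ≤-antisym; even≢odd; ≤-refl; ≤-reflexive; ≤-trans; m≤m+n; m≤n+m; +-suc; +-identityʳ; +-assoc; +-comm)
open import Data.Nat.Tactic.RingSolver using (solve-∀)
open import Data.Product using (Σ; ∃-syntax; _×_; _,_)
import Data.Product as Product
open import Data.Sum using (_⊎_; inj₁; inj₂)
import Data.Sum as Sum
open import Data.Unit using (⊤; tt)
open import Data.Vec using ([]; _∷_; here; there)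
open import Function using (_∘_; id)
open import Function.Definitions using (Injective)
open import Relation.Binary.PropositionalEquality
  using (_≡_; _≢_; refl; sym; trans; subst; cong; cong₂; ≢-sym; module ≡-Reasoning)
open import Relation.Nullary using (Dec; yes; no; ¬_; _×-dec_; ¬?)
open import Relation.Nullary.Decidable using (decidable-stable)
import Relation.Nullary.Decidable as Dec

-- Counting

∈-─⁺ : ∀ {A : Set} {x z : A} {ys : List A} (p : x ∈ ys) → z ∈ ys → z ≢ x → z ∈ ys ─ p
∈-─⁺ (here refl) (here refl) z≢x = ⊥-elim (z≢x refl)
∈-─⁺ (here _)    (there z∈)  _   = z∈
∈-─⁺ (there _)   (here refl) _   = here refl
∈-─⁺ (there p)   (there z∈)  z≢x = there (∈-─⁺ p z∈ z≢x)

Unique⇒length≤ : ∀ {A : Set} {xs ys : List A} → Unique xs → xs ⊆ ys → length xs ≤ length ys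
Unique⇒length≤ {xs = []} _ _ = z≤n
Unique⇒length≤ {xs = x ∷ xs} {ys} (x∉xs ∷ uniq) xs⊆ys =
  subst (suc (length xs) ≤_) (sym (length-removeAt′ ys (index x∈ys)))
    (s≤s (Unique⇒length≤ uniq λ z∈ → ∈-─⁺ x∈ys (xs⊆ys (there z∈)) (λ { refl → All.lookup x∉xs z∈ refl })))
  where
  x∈ys : x ∈ ys
  x∈ys = xs⊆ys (here refl)

elements : ∀ {n} → Subset n → List (Fin n)
elements []             = []
elements (inside  ∷ p) = zero ∷ map suc (elements p)
elements (outside ∷ p) = map suc (elements p)

length-elements : ∀ {n} (p : Subset n) → length (elements p) ≡ ∣ p ∣
length-elements []            = refl
length-elements (inside  ∷ p) = cong suc (trans (length-map suc (elements p)) (length-elements p))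
length-elements (outside ∷ p) = trans (length-map suc (elements p)) (length-elements p)

∈-elements⁺ : ∀ {n} {p : Subset n} {x} → x ∈ₛ p → x ∈ elements p
∈-elements⁺ {p = inside  ∷ p} here      = here refl
∈-elements⁺ {p = inside  ∷ p} (there x∈) = there (∈-map⁺ suc (∈-elements⁺ x∈))
∈-elements⁺ {p = outside ∷ p} (there x∈) = ∈-map⁺ suc (∈-elements⁺ x∈)

∈-elements⁻ : ∀ {n} (p : Subset n) {x} → x ∈ elements p → x ∈ₛ p
∈-elements⁻ (inside  ∷ p) (here refl) = here
∈-elements⁻ (inside  ∷ p) (there x∈) with ∈-map⁻ suc x∈
... | _ , y∈ , refl = there (∈-elements⁻ p y∈)
∈-elements⁻ (outside ∷ p) x∈ with ∈-map⁻ suc x∈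
... | _ , y∈ , refl = there (∈-elements⁻ p y∈)

elements-unique : ∀ {n} (p : Subset n) → Unique (elements p)
elements-unique []            = []
elements-unique (inside  ∷ p) = All.tabulate zero∉ ∷ Unique.map⁺ Fin.suc-injective (elements-unique p)
  where
  zero∉ : ∀ {x} → x ∈ map suc (elements p) → zero ≢ x
  zero∉ x∈ refl with ∈-map⁻ suc x∈
  ... | _ , _ , ()
elements-unique (outside ∷ p) = Unique.map⁺ Fin.suc-injective (elements-unique p)

∣p∣≤length : ∀ {n} {p : Subset n} {xs : List (Fin n)} → (∀ {x} → x ∈ₛ p → x ∈ xs) → ∣ p ∣ ≤ length xs
∣p∣≤length {p = p} p⊆xs =
  subst (_≤ _) (length-elements p) (Unique⇒length≤ (elements-unique p) (p⊆xs ∘ ∈-elements⁻ p))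

length≤∣p∣ : ∀ {n} {p : Subset n} {xs : List (Fin n)} → Unique xs → (∀ {x} → x ∈ xs → x ∈ₛ p) → length xs ≤ ∣ p ∣
length≤∣p∣ {p = p} uniq xs⊆p =
  subst (_ ≤_) (length-elements p) (Unique⇒length≤ uniq (∈-elements⁺ ∘ xs⊆p))

length≤n : ∀ {n} {xs : List (Fin n)} → Unique xs → length xs ≤ n
length≤n {n} {xs} uniq = subst (length xs ≤_) (length-tabulate id) (Unique⇒length≤ {ys = allFin n} uniq λ {x} _ → ∈-allFin x)

n≤length : ∀ {n} {xs : List (Fin n)} → (∀ x → x ∈ xs) → n ≤ length xs
n≤length {n} {xs} all∈ = subst (_≤ length xs) (length-tabulate id) (Unique⇒length≤ (Unique.allFin⁺ n) λ {x} _ → all∈ x)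

inject₁≢suc : ∀ {ℓ} (k : Fin ℓ) → inject₁ k ≢ suc k
inject₁≢suc zero    ()
inject₁≢suc (suc k) eq = inject₁≢suc k (Fin.suc-injective eq)

suc-inject₁⁻¹ : ∀ {ℓ} (k : Fin ℓ) → (∃[ k′ ] inject₁ k′ ≡ suc k) ⊎ suc k ≡ fromℕ ℓ
suc-inject₁⁻¹ {suc zero}    zero = inj₂ refl
suc-inject₁⁻¹ {suc (suc ℓ)} zero = inj₁ (suc zero , refl)
suc-inject₁⁻¹ {suc ℓ}       (suc k) with suc-inject₁⁻¹ k
... | inj₁ (k′ , eq) = inj₁ (suc k′ , cong suc eq)
... | inj₂ eq        = inj₂ (cong suc eq)

fromList : ∀ {n} → List (Fin n) → Subset n
fromList xs = ⋃ (map ⁅_⁆ xs)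

∈-fromList⁺ : ∀ {n} {x : Fin n} {xs} → x ∈ xs → x ∈ₛ fromList xs
∈-fromList⁺ (here refl) = x∈p∪q⁺ (inj₁ (x∈⁅x⁆ _))
∈-fromList⁺ (there x∈)  = x∈p∪q⁺ (inj₂ (∈-fromList⁺ x∈))

∈-fromList⁻ : ∀ {n} {x : Fin n} xs → x ∈ₛ fromList xs → x ∈ xs
∈-fromList⁻ []       x∈ = ⊥-elim (∉⊥ x∈)
∈-fromList⁻ (y ∷ xs) x∈ with x∈p∪q⁻ ⁅ y ⁆ (fromList xs) x∈
... | inj₁ x∈y  = here (x∈⁅y⁆⇒x≡y y x∈y)
... | inj₂ x∈xs = there (∈-fromList⁻ xs x∈xs)

module _ {n : ℕ} (H : ThreeGraph n) where

  V : Set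
  V = Fin n

  Tr : Set
  Tr = Fin (m H)

  record Triple (i : Tr) (a b c : V) : Set where
    field
      ∋a : a ∈ₛ Δ H i
      ∋b : b ∈ₛ Δ H i
      ∋c : c ∈ₛ Δ H i
      a≢b : a ≢ b
      a≢c : a ≢ c
      b≢c : b ≢ c
      only : ∀ {x} → x ∈ₛ Δ H i → x ≡ a ⊎ x ≡ b ⊎ x ≡ c
  open Triple public

  swap₁₂ : ∀ {i a b c} → Triple i a b c → Triple i b a c
  swap₁₂ t = record
    { ∋a = ∋b t ; ∋b = ∋a t ; ∋c = ∋c t ; a≢b = ≢-sym (a≢b t) ; a≢c = b≢c t ; b≢c = a≢c t
    ; only = λ x∈ → case (only t x∈) }
    where
    case : ∀ {A B C : Set} → A ⊎ B ⊎ C → B ⊎ A ⊎ C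
    case (inj₁ a)        = inj₂ (inj₁ a)
    case (inj₂ (inj₁ b)) = inj₁ b
    case (inj₂ (inj₂ c)) = inj₂ (inj₂ c)

  swap₂₃ : ∀ {i a b c} → Triple i a b c → Triple i a c b
  swap₂₃ t = record
    { ∋a = ∋a t ; ∋b = ∋c t ; ∋c = ∋b t ; a≢b = a≢c t ; a≢c = a≢b t ; b≢c = ≢-sym (b≢c t)
    ; only = λ x∈ → case (only t x∈) }
    where
    case : ∀ {A B C : Set} → A ⊎ B ⊎ C → A ⊎ C ⊎ B
    case (inj₁ a)        = inj₁ a
    case (inj₂ (inj₁ b)) = inj₂ (inj₂ b)
    case (inj₂ (inj₂ c)) = inj₂ (inj₁ c)

  third-vertex : ∀ {i u v} → u ∈ₛ Δ H i → v ∈ₛ Δ H i → u ≢ v → ∃[ z ] Triple i u v z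
  third-vertex {i} {u} {v} u∈ v∈ u≢v with Fin.any? (λ z → (z ∈ₛ? Δ H i) ×-dec ¬? (z ≟ᶠ u) ×-dec ¬? (z ≟ᶠ v))
  ... | no ∄z = ⊥-elim (≤⇒≯ (∣p∣≤length {xs = u ∷ v ∷ []} ⊆uv) (subst (2 <_) (sym (size3 H i)) ≤-refl))
    where
    ⊆uv : ∀ {x} → x ∈ₛ Δ H i → x ∈ u ∷ v ∷ []
    ⊆uv {x} x∈ with x ≟ᶠ u | x ≟ᶠ v
    ... | yes x≡u | _       = here x≡u
    ... | no _    | yes x≡v = there (here x≡v)
    ... | no x≢u  | no x≢v  = ⊥-elim (∄z (x , x∈ , x≢u , x≢v))
  ... | yes (z , z∈ , z≢u , z≢v) = z , record
    { ∋a = u∈ ; ∋b = v∈ ; ∋c = z∈ ; a≢b = u≢v ; a≢c = ≢-sym z≢u ; b≢c = ≢-sym z≢v ; only = only′ }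
    where
    only′ : ∀ {x} → x ∈ₛ Δ H i → x ≡ u ⊎ x ≡ v ⊎ x ≡ z
    only′ {x} x∈ with x ≟ᶠ u | x ≟ᶠ v | x ≟ᶠ z
    ... | yes x≡u | _       | _       = inj₁ x≡u
    ... | no _    | yes x≡v | _       = inj₂ (inj₁ x≡v)
    ... | no _    | no _    | yes x≡z = inj₂ (inj₂ x≡z)
    ... | no x≢u  | no x≢v  | no x≢z  =
      ⊥-elim (≤⇒≯ (length≤∣p∣ {p = Δ H i} uvzx-unique uvzx⊆) (subst (_< 4) (sym (size3 H i)) ≤-refl))
      where
      uvzx-unique : Unique (u ∷ v ∷ z ∷ x ∷ [])
      uvzx-unique = (u≢v ∷ ≢-sym z≢u ∷ ≢-sym x≢u ∷ []) ∷ (≢-sym z≢v ∷ ≢-sym x≢v ∷ []) ∷ (≢-sym x≢z ∷ []) ∷ [] ∷ []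
      uvzx⊆ : ∀ {y} → y ∈ u ∷ v ∷ z ∷ x ∷ [] → y ∈ₛ Δ H i
      uvzx⊆ (here refl)                         = u∈
      uvzx⊆ (there (here refl))                 = v∈
      uvzx⊆ (there (there (here refl)))         = z∈
      uvzx⊆ (there (there (there (here refl)))) = x∈

  -- Trees

  -- node t A B C is C extended at its root r by the triple t = {r, y, y′},
  -- which carries A at y and B at y′.
  data Tree : V → Set where
    leaf : ∀ r → Tree r
    node : ∀ {r y y′ i} → Triple i r y y′ → Tree y → Tree y′ → Tree r → Tree r

  infix 4 _∈ᵀ_ _∉ᵀ_ _#_

  data _∈ᵀ_ (v : V) : ∀ {r} → Tree r → Set where
    leaf : v ∈ᵀ leaf v
    in₁  : ∀ {r y y′ i} {t : Triple i r y y′} {A B C} → v ∈ᵀ A → v ∈ᵀ node t A B C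
    in₂  : ∀ {r y y′ i} {t : Triple i r y y′} {A B C} → v ∈ᵀ B → v ∈ᵀ node t A B C
    in₃  : ∀ {r y y′ i} {t : Triple i r y y′} {A B C} → v ∈ᵀ C → v ∈ᵀ node t A B C

  _∉ᵀ_ : ∀ {r} → V → Tree r → Set
  v ∉ᵀ T = ¬ v ∈ᵀ T

  _#_ : ∀ {r r′} → Tree r → Tree r′ → Set
  T # T′ = ∀ {v} → v ∈ᵀ T → v ∈ᵀ T′ → ⊥

  #-sym : ∀ {r r′} {T : Tree r} {T′ : Tree r′} → T # T′ → T′ # T
  #-sym T#T′ v∈T′ v∈T = T#T′ v∈T v∈T′

  size : ∀ {r} → Tree r → ℕ
  size (leaf _)       = 0
  size (node t A B C) = suc (size A + (size B + size C))

  Valid : ∀ {r} → Tree r → Set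
  Valid (leaf _)       = ⊤
  Valid (node t A B C) = Valid A × Valid B × Valid C × A # B × A # C × B # C

  root∈ : ∀ {r} (T : Tree r) → r ∈ᵀ T
  root∈ (leaf r)       = leaf
  root∈ (node t A B C) = in₃ (root∈ C)

  MeetOnlyAt : ∀ {r r′} → V → Tree r → Tree r′ → Set
  MeetOnlyAt z T T′ = ∀ {v} → v ∈ᵀ T → v ∈ᵀ T′ → v ≡ z

  graft : ∀ {r z} (T : Tree r) → Tree z → z ∈ᵀ T → Tree r
  graft (leaf r)       Z leaf       = Z
  graft (node t A B C) Z (in₁ z∈A) = node t (graft A Z z∈A) B C
  graft (node t A B C) Z (in₂ z∈B) = node t A (graft B Z z∈B) C
  graft (node t A B C) Z (in₃ z∈C) = node t A B (graft C Z z∈C)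

  module _ {z} (Z : Tree z) where

    ∈-graft⁻ : ∀ {r v} (T : Tree r) (z∈ : z ∈ᵀ T) → v ∈ᵀ graft T Z z∈ → v ∈ᵀ T ⊎ v ∈ᵀ Z
    ∈-graft⁻ (leaf r)       leaf      v∈       = inj₂ v∈
    ∈-graft⁻ (node t A B C) (in₁ z∈A) (in₁ v∈) = Sum.map₁ in₁ (∈-graft⁻ A z∈A v∈)
    ∈-graft⁻ (node t A B C) (in₁ z∈A) (in₂ v∈) = inj₁ (in₂ v∈)
    ∈-graft⁻ (node t A B C) (in₁ z∈A) (in₃ v∈) = inj₁ (in₃ v∈)
    ∈-graft⁻ (node t A B C) (in₂ z∈B) (in₁ v∈) = inj₁ (in₁ v∈)
    ∈-graft⁻ (node t A B C) (in₂ z∈B) (in₂ v∈) = Sum.map₁ in₂ (∈-graft⁻ B z∈B v∈)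
    ∈-graft⁻ (node t A B C) (in₂ z∈B) (in₃ v∈) = inj₁ (in₃ v∈)
    ∈-graft⁻ (node t A B C) (in₃ z∈C) (in₁ v∈) = inj₁ (in₁ v∈)
    ∈-graft⁻ (node t A B C) (in₃ z∈C) (in₂ v∈) = inj₁ (in₂ v∈)
    ∈-graft⁻ (node t A B C) (in₃ z∈C) (in₃ v∈) = Sum.map₁ in₃ (∈-graft⁻ C z∈C v∈)

    ∈-graft⁺ˡ : ∀ {r v} (T : Tree r) (z∈ : z ∈ᵀ T) → v ∈ᵀ T → v ∈ᵀ graft T Z z∈
    ∈-graft⁺ˡ (leaf r)       leaf      leaf     = root∈ Z
    ∈-graft⁺ˡ (node t A B C) (in₁ z∈A) (in₁ v∈) = in₁ (∈-graft⁺ˡ A z∈A v∈)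
    ∈-graft⁺ˡ (node t A B C) (in₁ z∈A) (in₂ v∈) = in₂ v∈
    ∈-graft⁺ˡ (node t A B C) (in₁ z∈A) (in₃ v∈) = in₃ v∈
    ∈-graft⁺ˡ (node t A B C) (in₂ z∈B) (in₁ v∈) = in₁ v∈
    ∈-graft⁺ˡ (node t A B C) (in₂ z∈B) (in₂ v∈) = in₂ (∈-graft⁺ˡ B z∈B v∈)
    ∈-graft⁺ˡ (node t A B C) (in₂ z∈B) (in₃ v∈) = in₃ v∈
    ∈-graft⁺ˡ (node t A B C) (in₃ z∈C) (in₁ v∈) = in₁ v∈
    ∈-graft⁺ˡ (node t A B C) (in₃ z∈C) (in₂ v∈) = in₂ v∈
    ∈-graft⁺ˡ (node t A B C) (in₃ z∈C) (in₃ v∈) = in₃ (∈-graft⁺ˡ C z∈C v∈)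

    ∈-graft⁺ʳ : ∀ {r v} (T : Tree r) (z∈ : z ∈ᵀ T) → v ∈ᵀ Z → v ∈ᵀ graft T Z z∈
    ∈-graft⁺ʳ (leaf r)       leaf      v∈ = v∈
    ∈-graft⁺ʳ (node t A B C) (in₁ z∈A) v∈ = in₁ (∈-graft⁺ʳ A z∈A v∈)
    ∈-graft⁺ʳ (node t A B C) (in₂ z∈B) v∈ = in₂ (∈-graft⁺ʳ B z∈B v∈)
    ∈-graft⁺ʳ (node t A B C) (in₃ z∈C) v∈ = in₃ (∈-graft⁺ʳ C z∈C v∈)

    size-graft : ∀ {r} (T : Tree r) (z∈ : z ∈ᵀ T) → size (graft T Z z∈) ≡ size T + size Z
    size-graft (leaf r)       leaf      = refl
    size-graft (node t A B C) (in₁ z∈A) rewrite size-graft A z∈A = arith (size A) (size Z) (size B) (size C)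
      where
      arith : ∀ a z b c → 1 + (a + z + (b + c)) ≡ 1 + (a + (b + c)) + z
      arith = solve-∀
    size-graft (node t A B C) (in₂ z∈B) rewrite size-graft B z∈B = arith (size A) (size Z) (size B) (size C)
      where
      arith : ∀ a z b c → 1 + (a + (b + z + c)) ≡ 1 + (a + (b + c)) + z
      arith = solve-∀
    size-graft (node t A B C) (in₃ z∈C) rewrite size-graft C z∈C = arith (size A) (size Z) (size B) (size C)
      where
      arith : ∀ a z b c → 1 + (a + (b + (c + z))) ≡ 1 + (a + (b + c)) + z
      arith = solve-∀

    graft-# : ∀ {r r′} (T : Tree r) (z∈ : z ∈ᵀ T) {S : Tree r′} → T # S → MeetOnlyAt z S Z → graft T Z z∈ # S
    graft-# T z∈ T#S meet v∈ v∈S with ∈-graft⁻ T z∈ v∈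
    ... | inj₁ v∈T = T#S v∈T v∈S
    ... | inj₂ v∈Z with meet v∈S v∈Z
    ...   | refl = T#S z∈ v∈S

    graft-valid : ∀ {r} (T : Tree r) (z∈ : z ∈ᵀ T) → Valid T → Valid Z → MeetOnlyAt z T Z → Valid (graft T Z z∈)
    graft-valid (leaf r)       leaf      _ vZ _ = vZ
    graft-valid (node t A B C) (in₁ z∈A) (vA , vB , vC , A#B , A#C , B#C) vZ meet =
      graft-valid A z∈A vA vZ (meet ∘ in₁) , vB , vC ,
      graft-# A z∈A A#B (meet ∘ in₂) , graft-# A z∈A A#C (meet ∘ in₃) , B#C
    graft-valid (node t A B C) (in₂ z∈B) (vA , vB , vC , A#B , A#C , B#C) vZ meet =
      vA , graft-valid B z∈B vB vZ (meet ∘ in₂) , vC ,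
      #-sym (graft-# B z∈B (#-sym A#B) (meet ∘ in₁)) , A#C , graft-# B z∈B B#C (meet ∘ in₃)
    graft-valid (node t A B C) (in₃ z∈C) (vA , vB , vC , A#B , A#C , B#C) vZ meet =
      vA , vB , graft-valid C z∈C vC vZ (meet ∘ in₃) , A#B ,
      #-sym (graft-# C z∈C (#-sym A#C) (meet ∘ in₁)) , #-sym (graft-# C z∈C (#-sym B#C) (meet ∘ in₂))

  hang : ∀ {r x a b i} (T : Tree r) → x ∈ᵀ T → Triple i x a b → Tree a → Tree r
  hang T x∈ t A = graft T (node t A (leaf _) (leaf _)) x∈

  module _ {r x a b i} (T : Tree r) (x∈ : x ∈ᵀ T) (t : Triple i x a b) (A : Tree a) where

    ∈-hang⁻ : ∀ {v} → v ∈ᵀ hang T x∈ t A → v ∈ᵀ T ⊎ v ∈ᵀ A ⊎ v ≡ b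
    ∈-hang⁻ v∈ with ∈-graft⁻ (node t A (leaf b) (leaf x)) T x∈ v∈
    ... | inj₁ v∈T         = inj₁ v∈T
    ... | inj₂ (in₁ v∈A)   = inj₂ (inj₁ v∈A)
    ... | inj₂ (in₂ leaf)  = inj₂ (inj₂ refl)
    ... | inj₂ (in₃ leaf)  = inj₁ x∈

    ∈-hang⁺ᵀ : ∀ {v} → v ∈ᵀ T → v ∈ᵀ hang T x∈ t A
    ∈-hang⁺ᵀ = ∈-graft⁺ˡ _ T x∈

    ∈-hang⁺ᴬ : ∀ {v} → v ∈ᵀ A → v ∈ᵀ hang T x∈ t A
    ∈-hang⁺ᴬ = ∈-graft⁺ʳ _ T x∈ ∘ in₁

    size-hang : size (hang T x∈ t A) ≡ suc (size T + size A)
    size-hang = trans (size-graft _ T x∈) (trans (+-suc (size T) _) (cong (λ s → suc (size T + s)) (+-identityʳ (size A))))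

    hang-valid : Valid T → Valid A → T # A → b ∉ᵀ T → b ∉ᵀ A → Valid (hang T x∈ t A)
    hang-valid vT vA T#A b∉T b∉A = graft-valid _ T x∈ vT vZ meet
      where
      vZ : Valid (node t A (leaf b) (leaf x))
      vZ = vA , tt , tt , (λ { v∈A leaf → b∉A v∈A }) , (λ { v∈A leaf → T#A x∈ v∈A }) , (λ { leaf leaf → a≢c t refl })
      meet : MeetOnlyAt x T (node t A (leaf b) (leaf x))
      meet v∈T (in₁ v∈A)  = ⊥-elim (T#A v∈T v∈A)
      meet v∈T (in₂ leaf) = ⊥-elim (b∉T v∈T)
      meet v∈T (in₃ leaf) = refl

  TreeOfSize : ℕ → Set
  TreeOfSize s = ∃[ r ] Σ (Tree r) λ T → Valid T × size T ≡ s

  add-pendant : ∀ {r x a b i} (T : Tree r) → x ∈ᵀ T → Triple i x a b → Valid T → a ∉ᵀ T → b ∉ᵀ T →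
                TreeOfSize (suc (size T))
  add-pendant T x∈ t vT a∉T b∉T =
    _ , hang T x∈ t (leaf _) ,
    hang-valid T x∈ t (leaf _) vT tt (λ { v∈T leaf → a∉T v∈T }) b∉T (λ { leaf → b≢c t refl }) ,
    trans (size-hang T x∈ t (leaf _)) (cong suc (+-identityʳ (size T)))

  record Split {q} (T : Tree q) (z : V) : Set where
    field
      {j y y′} : _
      triple : Triple j q y y′
      below  : Tree y
      beside : Tree y′
      rest   : Tree q
      size≡  : size T ≡ size (node triple below beside rest)
      ⊆T     : ∀ {v} → v ∈ᵀ node triple below beside rest → v ∈ᵀ T
      valid  : Valid (node triple below beside rest)
      z∈     : z ∈ᵀ below

  split : ∀ {q z} (T : Tree q) → Valid T → z ∈ᵀ T → z ≢ q → Split T z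
  split (leaf q) _ leaf z≢q = ⊥-elim (z≢q refl)
  split (node t A B C) vT (in₁ z∈A) _ = record
    { triple = t ; below = A ; beside = B ; rest = C ; size≡ = refl ; ⊆T = id ; valid = vT ; z∈ = z∈A }
  split (node t A B C) (vA , vB , vC , A#B , A#C , B#C) (in₂ z∈B) _ = record
    { triple = swap₂₃ t ; below = B ; beside = A ; rest = C
    ; size≡  = cong suc (trans (sym (+-assoc (size A) (size B) (size C)))
                        (trans (cong (_+ size C) (+-comm (size A) (size B))) (+-assoc (size B) (size A) (size C))))
    ; ⊆T     = λ { (in₁ v∈) → in₂ v∈ ; (in₂ v∈) → in₁ v∈ ; (in₃ v∈) → in₃ v∈ }
    ; valid  = vB , vA , vC , #-sym A#B , B#C , A#C
    ; z∈     = z∈B }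
  split {z = z} (node t A B C) (vA , vB , vC , A#B , A#C , B#C) (in₃ z∈C) z≢q = lift (split C vC z∈C z≢q)
    where
    arith : ∀ a b c d e → 1 + (a + (b + (1 + (c + (d + e))))) ≡ 1 + (c + (d + (1 + (a + (b + e)))))
    arith = solve-∀
    lift : Split C z → Split (node t A B C) z
    lift record { triple = s ; below = Y ; beside = Y′ ; rest = R ; size≡ = size≡ ; ⊆T = ⊆C
                ; valid = vY , vY′ , vR , Y#Y′ , Y#R , Y′#R ; z∈ = z∈Y } = record
      { triple = s ; below = Y ; beside = Y′ ; rest = node t A B R
      ; size≡  = trans (cong (λ c → 1 + (size A + (size B + c))) size≡)
                       (arith (size A) (size B) (size Y) (size Y′) (size R))
      ; ⊆T     = ⊆T
      ; valid  = vY , vY′ , (vA , vB , vR , A#B , A#R , B#R) , Y#Y′ , part# Y#R (⊆C ∘ in₁) , part# Y′#R (⊆C ∘ in₂)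
      ; z∈     = z∈Y }
      where
      A#R : A # R
      A#R v∈A v∈R = A#C v∈A (⊆C (in₃ v∈R))
      B#R : B # R
      B#R v∈B v∈R = B#C v∈B (⊆C (in₃ v∈R))
      part# : ∀ {p} {P : Tree p} → P # R → (∀ {v} → v ∈ᵀ P → v ∈ᵀ C) → P # node t A B R
      part# P#R P⊆C v∈P (in₁ v∈A) = A#C v∈A (P⊆C v∈P)
      part# P#R P⊆C v∈P (in₂ v∈B) = B#C v∈B (P⊆C v∈P)
      part# P#R P⊆C v∈P (in₃ v∈R) = P#R v∈P v∈R
      ⊆T : ∀ {v} → v ∈ᵀ node s Y Y′ (node t A B R) → v ∈ᵀ node t A B C
      ⊆T (in₁ v∈)       = in₃ (⊆C (in₁ v∈))
      ⊆T (in₂ v∈)       = in₃ (⊆C (in₂ v∈))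
      ⊆T (in₃ (in₁ v∈)) = in₁ v∈
      ⊆T (in₃ (in₂ v∈)) = in₂ v∈
      ⊆T (in₃ (in₃ v∈)) = in₃ (⊆C (in₃ v∈))

  module _ {q z} (C : Tree q) {B : Tree q} (S : Split B z) where
    open Split S

    merge : Tree q
    merge = node triple below beside (graft C rest (root∈ C))

    ∈-merge⁻ : ∀ {v} → v ∈ᵀ merge → v ∈ᵀ C ⊎ v ∈ᵀ B
    ∈-merge⁻ (in₁ v∈) = inj₂ (⊆T (in₁ v∈))
    ∈-merge⁻ (in₂ v∈) = inj₂ (⊆T (in₂ v∈))
    ∈-merge⁻ (in₃ v∈) = Sum.map₂ (⊆T ∘ in₃) (∈-graft⁻ rest C (root∈ C) v∈)

    size-merge : size merge ≡ size C + size B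
    size-merge = begin
      1 + (size below + (size beside + size (graft C rest (root∈ C))))
        ≡⟨ cong (λ r → 1 + (size below + (size beside + r))) (size-graft rest C (root∈ C)) ⟩
      1 + (size below + (size beside + (size C + size rest)))
        ≡⟨ arith (size below) (size beside) (size C) (size rest) ⟩
      size C + size (node triple below beside rest)
        ≡⟨ cong (size C +_) size≡ ⟨
      size C + size B ∎
      where
      open ≡-Reasoning
      arith : ∀ a b c d → 1 + (a + (b + (c + d))) ≡ c + (1 + (a + (b + d)))
      arith = solve-∀

    merge-valid : Valid C → MeetOnlyAt q C B → Valid merge
    merge-valid vC meet with valid
    ... | vbelow , vbeside , vrest , below#beside , below#rest , beside#rest =
      vbelow , vbeside , graft-valid rest C (root∈ C) vC vrest (λ v∈C v∈rest → meet v∈C (⊆T (in₃ v∈rest))) ,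
      below#beside , part# below#rest (⊆T ∘ in₁) , part# beside#rest (⊆T ∘ in₂)
      where
      part# : ∀ {p} {P : Tree p} → P # rest → (∀ {v} → v ∈ᵀ P → v ∈ᵀ B) → P # graft C rest (root∈ C)
      part# P#rest P⊆B v∈P v∈R with ∈-graft⁻ rest C (root∈ C) v∈R
      ... | inj₂ v∈rest = P#rest v∈P v∈rest
      ... | inj₁ v∈C with meet v∈C (P⊆B v∈P)
      ...   | refl = P#rest v∈P (root∈ rest)

  vertices : ∀ {r} → Tree r → List V
  vertices (leaf r)       = [ r ]
  vertices (node t A B C) = vertices A ++ vertices B ++ vertices C

  ∈-vertices⁺ : ∀ {r v} {T : Tree r} → v ∈ᵀ T → v ∈ vertices T
  ∈-vertices⁺ leaf                            = here refl
  ∈-vertices⁺                          (in₁ v∈) = ∈-++⁺ˡ (∈-vertices⁺ v∈)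
  ∈-vertices⁺ {T = node t A B C}       (in₂ v∈) = ∈-++⁺ʳ (vertices A) (∈-++⁺ˡ (∈-vertices⁺ v∈))
  ∈-vertices⁺ {T = node t A B C}       (in₃ v∈) = ∈-++⁺ʳ (vertices A) (∈-++⁺ʳ (vertices B) (∈-vertices⁺ v∈))

  ∈-vertices⁻ : ∀ {r v} (T : Tree r) → v ∈ vertices T → v ∈ᵀ T
  ∈-vertices⁻ (leaf r)       (here refl) = leaf
  ∈-vertices⁻ (node t A B C) v∈ with ∈-++⁻ (vertices A) v∈
  ... | inj₁ v∈A = in₁ (∈-vertices⁻ A v∈A)
  ... | inj₂ v∈BC with ∈-++⁻ (vertices B) v∈BC
  ...   | inj₁ v∈B = in₂ (∈-vertices⁻ B v∈B)
  ...   | inj₂ v∈C = in₃ (∈-vertices⁻ C v∈C)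

  open DecMembership (_≟ᶠ_ {n}) using (_∈?_)

  _∈ᵀ?_ : ∀ {r} v (T : Tree r) → Dec (v ∈ᵀ T)
  v ∈ᵀ? T = Dec.map′ (∈-vertices⁻ T) ∈-vertices⁺ (v ∈? vertices T)

  vertices-unique : ∀ {r} (T : Tree r) → Valid T → Unique (vertices T)
  vertices-unique (leaf r)       _                                  = [] ∷ []
  vertices-unique (node t A B C) (vA , vB , vC , A#B , A#C , B#C) =
    Unique.++⁺ (vertices-unique A vA) (Unique.++⁺ (vertices-unique B vB) (vertices-unique C vC) B#C′) A#BC
    where
    B#C′ : Disjoint (vertices B) (vertices C)
    B#C′ (v∈B , v∈C) = B#C (∈-vertices⁻ B v∈B) (∈-vertices⁻ C v∈C)
    A#BC : Disjoint (vertices A) (vertices B ++ vertices C)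
    A#BC (v∈A , v∈BC) with ∈-++⁻ (vertices B) v∈BC
    ... | inj₁ v∈B = A#B (∈-vertices⁻ A v∈A) (∈-vertices⁻ B v∈B)
    ... | inj₂ v∈C = A#C (∈-vertices⁻ A v∈A) (∈-vertices⁻ C v∈C)

  length-vertices : ∀ {r} (T : Tree r) → length (vertices T) ≡ 1 + (size T + size T)
  length-vertices (leaf r)       = refl
  length-vertices (node t A B C) = begin
    length (vertices A ++ vertices B ++ vertices C)
      ≡⟨ length-++ (vertices A) ⟩
    length (vertices A) + length (vertices B ++ vertices C)
      ≡⟨ cong (length (vertices A) +_) (length-++ (vertices B)) ⟩
    length (vertices A) + (length (vertices B) + length (vertices C))
      ≡⟨ cong₂ _+_ (length-vertices A) (cong₂ _+_ (length-vertices B) (length-vertices C)) ⟩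
    1 + (size A + size A) + ((1 + (size B + size B)) + (1 + (size C + size C)))
      ≡⟨ arith (size A) (size B) (size C) ⟩
    1 + (size (node t A B C) + size (node t A B C)) ∎
    where
    open ≡-Reasoning
    arith : ∀ a b c → 1 + (a + a) + ((1 + (b + b)) + (1 + (c + c))) ≡ 1 + ((1 + (a + (b + c))) + (1 + (a + (b + c))))
    arith = solve-∀

  -- Enlarging a tree

  module Extension (covering : PairCovering H) where

    triple-through : ∀ u v → u ≢ v → ∃[ i ] ∃[ z ] Triple i u v z
    triple-through u v u≢v with covering u v u≢v
    ... | i , u∈ , v∈ = i , third-vertex u∈ v∈ u≢v

    mutual
      extendAt : (k : ℕ) → ∀ {q z w w′ i} (C B : Tree q) → size B ≤ k → Valid C → Valid B → MeetOnlyAt q C B →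
                 w ≢ w′ → w ∉ᵀ C → w ∉ᵀ B → w′ ∉ᵀ C → w′ ∉ᵀ B → Triple i q z w → z ∈ᵀ B →
                 TreeOfSize (suc (size C + size B))
      extendAt k C B size≤k vC vB meet w≢w′ w∉C w∉B w′∉C w′∉B h z∈B =
        subst TreeOfSize (cong suc (size-merge C S))
          (extendBelow k triple below beside _ beside<k (merge-valid C S vC meet) w≢w′ (∉merge w∉C w∉B) (∉merge w′∉C w′∉B) h z∈)
        where
        S : Split B _
        S = split B vB z∈B (≢-sym (a≢b h))
        open Split S
        ∉merge : ∀ {v} → v ∉ᵀ C → v ∉ᵀ B → v ∉ᵀ merge C S
        ∉merge v∉C v∉B = Sum.[ v∉C , v∉B ] ∘ ∈-merge⁻ C S
        beside<k : size beside < k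
        beside<k = ≤-trans (s≤s (≤-trans (m≤m+n (size beside) (size rest)) (m≤n+m _ (size below))))
                           (≤-trans (≤-reflexive (sym size≡)) size≤k)

      extendBelow : (k : ℕ) → ∀ {q y y′ z w w′ i j} (t : Triple j q y y′) (Y : Tree y) (Y′ : Tree y′) (R : Tree q) →
                    size Y′ < k → Valid (node t Y Y′ R) → w ≢ w′ → w ∉ᵀ node t Y Y′ R → w′ ∉ᵀ node t Y Y′ R →
                    Triple i q z w → z ∈ᵀ Y → TreeOfSize (suc (size (node t Y Y′ R)))
      extendBelow (suc k) {q} {y} {y′} {z} {w} {w′} t Y Y′ R (s≤s size≤k)
                  vW@(vY , vY′ , vR , Y#Y′ , Y#R , Y′#R) w≢w′ w∉W w′∉W h z∈Y = result
        where
        X : Tree y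
        X = hang Y z∈Y (swap₁₂ h) R
        vX : Valid X
        vX = hang-valid Y z∈Y (swap₁₂ h) R vY vR Y#R (w∉W ∘ in₁) (w∉W ∘ in₃)
        X#Y′ : X # Y′
        X#Y′ v∈X v∈Y′ with ∈-hang⁻ Y z∈Y (swap₁₂ h) R v∈X
        ... | inj₁ v∈Y          = Y#Y′ v∈Y v∈Y′
        ... | inj₂ (inj₁ v∈R)   = Y′#R v∈Y′ v∈R
        ... | inj₂ (inj₂ refl)  = w∉W (in₂ v∈Y′)
        w′∉X : w′ ∉ᵀ X
        w′∉X w′∈X with ∈-hang⁻ Y z∈Y (swap₁₂ h) R w′∈X
        ... | inj₁ w′∈Y         = w′∉W (in₁ w′∈Y)
        ... | inj₂ (inj₁ w′∈R)  = w′∉W (in₃ w′∈R)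
        ... | inj₂ (inj₂ w′≡w)  = w≢w′ (sym w′≡w)
        y′≢w′ : y′ ≢ w′
        y′≢w′ refl = w′∉W (in₂ (root∈ Y′))

        reattach : ∀ {i′ z′} → Triple i′ y′ w′ z′ → z′ ∈ᵀ X → TreeOfSize (suc (size (node t Y Y′ R)))
        reattach {z′ = z′} h′ z′∈X = _ , hang X z′∈X h″ Y′ , hang-valid X z′∈X h″ Y′ vX vY′ X#Y′ w′∉X (w′∉W ∘ in₂) ,
                           trans (size-hang X z′∈X h″ Y′)
                                 (trans (cong (λ x → suc (x + size Y′)) (size-hang Y z∈Y (swap₁₂ h) R))
                                        (arith (size Y) (size R) (size Y′)))
          where
          h″ : Triple _ z′ y′ w′
          h″ = swap₁₂ (swap₂₃ h′)
          arith : ∀ a b c → 1 + (1 + (a + b) + c) ≡ 1 + (1 + (a + (c + b)))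
          arith = solve-∀

        descend : ∀ {i′ z′} → Triple i′ y′ w′ z′ → z′ ∈ᵀ Y′ → TreeOfSize (suc (size (node t Y Y′ R)))
        descend h′ z′∈Y′ =
          subst TreeOfSize (arith (size Y) (size R) (size Y′))
            (extendAt k C′ Y′ size≤k vC′ vY′ meet (≢-sym w≢w′) w′∉C′ (w′∉W ∘ in₂) w∉C′ (w∉W ∘ in₂) (swap₂₃ h′) z′∈Y′)
          where
          C′ : Tree y′
          C′ = node (swap₁₂ (swap₂₃ t)) R Y (leaf y′)
          vC′ : Valid C′
          vC′ = vR , vY , tt , #-sym Y#R , (λ { v∈R leaf → Y′#R (root∈ Y′) v∈R }) , (λ { v∈Y leaf → Y#Y′ v∈Y (root∈ Y′) })
          meet : MeetOnlyAt y′ C′ Y′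
          meet (in₁ v∈R) v∈Y′    = ⊥-elim (Y′#R v∈Y′ v∈R)
          meet (in₂ v∈Y) v∈Y′    = ⊥-elim (Y#Y′ v∈Y v∈Y′)
          meet (in₃ leaf) _      = refl
          w′∉C′ : w′ ∉ᵀ C′
          w′∉C′ (in₁ w′∈R)  = w′∉W (in₃ w′∈R)
          w′∉C′ (in₂ w′∈Y)  = w′∉W (in₁ w′∈Y)
          w′∉C′ (in₃ leaf)  = y′≢w′ refl
          w∉C′ : w ∉ᵀ C′
          w∉C′ (in₁ w∈R)  = w∉W (in₃ w∈R)
          w∉C′ (in₂ w∈Y)  = w∉W (in₁ w∈Y)
          w∉C′ (in₃ leaf) = w∉W (in₂ (root∈ Y′))
          arith : ∀ a b c → 1 + (1 + (b + (a + 0)) + c) ≡ 1 + (1 + (a + (c + b)))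
          arith = solve-∀

        pendant : ∀ {i′ z′} → Triple i′ y′ w′ z′ → z′ ∉ᵀ X → z′ ∉ᵀ Y′ → TreeOfSize (suc (size (node t Y Y′ R)))
        pendant {z′ = z′} h′ z′∉X z′∉Y′ = add-pendant (node t Y Y′ R) (in₂ (root∈ Y′)) h′ vW w′∉W z′∉W
          where
          z′∉W : z′ ∉ᵀ node t Y Y′ R
          z′∉W (in₁ z′∈Y)  = z′∉X (∈-hang⁺ᵀ Y z∈Y (swap₁₂ h) R z′∈Y)
          z′∉W (in₂ z′∈Y′) = z′∉Y′ z′∈Y′
          z′∉W (in₃ z′∈R)  = z′∉X (∈-hang⁺ᴬ Y z∈Y (swap₁₂ h) R z′∈R)

        result : TreeOfSize (suc (size (node t Y Y′ R)))
        result with triple-through y′ w′ y′≢w′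
        ... | _ , z′ , h′ with z′ ∈ᵀ? X | z′ ∈ᵀ? Y′
        ...   | yes z′∈X | _          = reattach h′ z′∈X
        ...   | no z′∉X  | yes z′∈Y′  = descend h′ z′∈Y′
        ...   | no z′∉X  | no z′∉Y′   = pendant h′ z′∉X z′∉Y′

    extend : ∀ {ρ} (T : Tree ρ) → Valid T → ∀ {w w′} → w ≢ w′ → w ∉ᵀ T → w′ ∉ᵀ T → TreeOfSize (suc (size T))
    extend {ρ} T vT {w} {w′} w≢w′ w∉T w′∉T with triple-through ρ w (λ { refl → w∉T (root∈ T) })
    ... | i , z , h with z ∈ᵀ? T
    ...   | yes z∈T = extendAt (size T) (leaf ρ) T ≤-refl tt vT (λ { leaf _ → refl }) w≢w′
                               (λ { leaf → w∉T (root∈ T) }) w∉T (λ { leaf → w′∉T (root∈ T) }) w′∉T (swap₂₃ h) z∈T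
    ...   | no z∉T  = add-pendant T (root∈ T) h vT w∉T z∉T

  size<n : ∀ {r} (T : Tree r) → Valid T → size T < n
  size<n T vT = ≤-trans (subst (size T <_) (sym (length-vertices T)) (s≤s (m≤m+n (size T) (size T))))
                        (length≤n (vertices-unique T vT))

  ¬covers-all-but : Odd n → ∀ {r} (T : Tree r) → Valid T → ∀ {w} → w ∉ᵀ T → ¬ (∀ v → v ≢ w → v ∈ᵀ T)
  ¬covers-all-but (k , n≡2k+1) T vT {w} w∉T covers = even≢odd (suc (size T)) k (begin
    2 * suc (size T)                  ≡⟨ arith (size T) ⟩
    1 + (1 + (size T + size T))       ≡⟨ cong suc (length-vertices T) ⟨
    length (w ∷ vertices T)           ≡⟨ ≤-antisym (n≤length all∈) (length≤n uniq) ⟨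
    n                                 ≡⟨ n≡2k+1 ⟩
    2 * k + 1                         ≡⟨ +-comm (2 * k) 1 ⟩
    suc (2 * k)                       ∎)
    where
    open ≡-Reasoning
    arith : ∀ s → 2 * (1 + s) ≡ 1 + (1 + (s + s))
    arith = solve-∀
    uniq : Unique (w ∷ vertices T)
    uniq = All.tabulate (λ v∈ w≡v → w∉T (subst (_∈ᵀ T) (sym w≡v) (∈-vertices⁻ T v∈))) ∷ vertices-unique T vT
    all∈ : ∀ v → v ∈ w ∷ vertices T
    all∈ v with v ≟ᶠ w
    ... | yes v≡w = here v≡w
    ... | no v≢w  = there (∈-vertices⁺ (covers v v≢w))

  record Spanning : Set where
    field
      root  : V
      tree  : Tree root
      valid : Valid tree
      spans : ∀ v → v ∈ᵀ tree

  module Growth (covering : PairCovering H) (odd : Odd n) where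
    open Extension covering

    grow : (fuel : ℕ) → ∀ {r} (T : Tree r) → Valid T → n ≤ fuel + size T → Spanning
    grow fuel T vT n≤ with Fin.any? (λ v → ¬? (v ∈ᵀ? T))
    ... | no ∄v = record { tree = T ; valid = vT ; spans = λ v → decidable-stable (v ∈ᵀ? T) (λ v∉ → ∄v (v , v∉)) }
    ... | yes (w , w∉T) with Fin.any? (λ v → ¬? (v ∈ᵀ? T) ×-dec ¬? (v ≟ᶠ w))
    ...   | no ∄v = ⊥-elim (¬covers-all-but odd T vT w∉T λ v v≢w → decidable-stable (v ∈ᵀ? T) (λ v∉ → ∄v (v , v∉ , v≢w)))
    ...   | yes (w′ , w′∉T , w′≢w) with fuel
    ...     | zero      = ⊥-elim (≤⇒≯ n≤ (size<n T vT))
    ...     | suc fuel′ with extend T vT (≢-sym w′≢w) w∉T w′∉T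
    ...       | _ , T′ , vT′ , size≡ =
      grow fuel′ T′ vT′ (subst (λ s → n ≤ fuel′ + s) (sym size≡) (subst (n ≤_) (sym (+-suc fuel′ (size T))) n≤))

  -- The triples of a tree

  triples : ∀ {r} → Tree r → List Tr
  triples (leaf _)               = []
  triples (node {i = i} t A B C) = triples A ++ triples B ++ i ∷ triples C

  data InTriples {r y y′ i} (t : Triple i r y y′) (A : Tree y) (B : Tree y′) (C : Tree r) (j : Tr) : Set where
    in₁ : j ∈ triples A → InTriples t A B C j
    in₂ : j ∈ triples B → InTriples t A B C j
    at  : j ≡ i → InTriples t A B C j
    in₃ : j ∈ triples C → InTriples t A B C j

  locate : ∀ {r y y′ i j} (t : Triple i r y y′) (A : Tree y) (B : Tree y′) (C : Tree r) →
           j ∈ triples (node t A B C) → InTriples t A B C j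
  locate _ A B C j∈ with ∈-++⁻ (triples A) j∈
  ... | inj₁ j∈A = in₁ j∈A
  ... | inj₂ j∈BC with ∈-++⁻ (triples B) j∈BC
  ...   | inj₁ j∈B          = in₂ j∈B
  ...   | inj₂ (here j≡i)   = at j≡i
  ...   | inj₂ (there j∈C)  = in₃ j∈C

  module _ {r y y′ i} (t : Triple i r y y′) (A : Tree y) (B : Tree y′) (C : Tree r) where

    ∈-triples₁ : ∀ {j} → j ∈ triples A → j ∈ triples (node t A B C)
    ∈-triples₁ = ∈-++⁺ˡ

    ∈-triples₂ : ∀ {j} → j ∈ triples B → j ∈ triples (node t A B C)
    ∈-triples₂ = ∈-++⁺ʳ (triples A) ∘ ∈-++⁺ˡ

    ∈-triples₃ : ∀ {j} → j ∈ triples C → j ∈ triples (node t A B C)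
    ∈-triples₃ = ∈-++⁺ʳ (triples A) ∘ ∈-++⁺ʳ (triples B) ∘ there

    ∈-triplesᵗ : i ∈ triples (node t A B C)
    ∈-triplesᵗ = ∈-++⁺ʳ (triples A) (∈-++⁺ʳ (triples B) (here refl))

  triple⊆vertices : ∀ {r} (T : Tree r) {j x} → j ∈ triples T → x ∈ₛ Δ H j → x ∈ᵀ T
  triple⊆vertices (node t A B C) j∈ x∈ with locate t A B C j∈
  ... | in₁ j∈A = in₁ (triple⊆vertices A j∈A x∈)
  ... | in₂ j∈B = in₂ (triple⊆vertices B j∈B x∈)
  ... | in₃ j∈C = in₃ (triple⊆vertices C j∈C x∈)
  ... | at refl with only t x∈
  ...   | inj₁ refl        = in₃ (root∈ C)
  ...   | inj₂ (inj₁ refl) = in₁ (root∈ A)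
  ...   | inj₂ (inj₂ refl) = in₂ (root∈ B)

  triple-vertex : ∀ {r} (T : Tree r) {j} → j ∈ triples T → ∃[ x ] x ∈ₛ Δ H j
  triple-vertex (node t A B C) j∈ with locate t A B C j∈
  ... | in₁ j∈A = triple-vertex A j∈A
  ... | in₂ j∈B = triple-vertex B j∈B
  ... | in₃ j∈C = triple-vertex C j∈C
  ... | at refl = _ , ∋a t

  #⇒triples-disjoint : ∀ {r r′} (T : Tree r) (T′ : Tree r′) → T # T′ → Disjoint (triples T) (triples T′)
  #⇒triples-disjoint T T′ T#T′ (j∈T , j∈T′) with triple-vertex T j∈T
  ... | x , x∈ = T#T′ (triple⊆vertices T j∈T x∈) (triple⊆vertices T′ j∈T′ x∈)

  -- Paths

  data Walk : ℕ → V → V → Set where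
    []   : ∀ {x} → Walk 0 x x
    step : ∀ {ℓ x y z} (i : Tr) → x ∈ₛ Δ H i → y ∈ₛ Δ H i → Walk ℓ y z → Walk (suc ℓ) x z

  walk-vertices : ∀ {ℓ x y} → Walk ℓ x y → List V
  walk-vertices ([] {x})               = [ x ]
  walk-vertices (step {x = x} _ _ _ p) = x ∷ walk-vertices p

  walk-triples : ∀ {ℓ x y} → Walk ℓ x y → List Tr
  walk-triples []             = []
  walk-triples (step i _ _ p) = i ∷ walk-triples p

  Simple : ∀ {ℓ x y} → Walk ℓ x y → Set
  Simple []                     = ⊤
  Simple (step {x = x} i _ _ p) = x ∉ walk-vertices p × i ∉ walk-triples p × Simple p

  _++ʷ_ : ∀ {ℓ₁ ℓ₂ x y z} → Walk ℓ₁ x y → Walk ℓ₂ y z → Walk (ℓ₁ + ℓ₂) x z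
  []              ++ʷ q = q
  step i x∈ y∈ p ++ʷ q = step i x∈ y∈ (p ++ʷ q)

  end∈ : ∀ {ℓ x y} (p : Walk ℓ x y) → y ∈ walk-vertices p
  end∈ []             = here refl
  end∈ (step _ _ _ p) = there (end∈ p)

  ∈-++ʷ⁻ : ∀ {ℓ₁ ℓ₂ x y z v} (p : Walk ℓ₁ x y) (q : Walk ℓ₂ y z) →
           v ∈ walk-vertices (p ++ʷ q) → v ∈ walk-vertices p ⊎ v ∈ walk-vertices q
  ∈-++ʷ⁻ []             q v∈          = inj₂ v∈
  ∈-++ʷ⁻ (step _ _ _ p) q (here refl) = inj₁ (here refl)
  ∈-++ʷ⁻ (step _ _ _ p) q (there v∈)  = Sum.map₁ there (∈-++ʷ⁻ p q v∈)

  walk-triples-++ʷ : ∀ {ℓ₁ ℓ₂ x y z} (p : Walk ℓ₁ x y) (q : Walk ℓ₂ y z) →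
                     walk-triples (p ++ʷ q) ≡ walk-triples p ++ walk-triples q
  walk-triples-++ʷ []             q = refl
  walk-triples-++ʷ (step i _ _ p) q = cong (i ∷_) (walk-triples-++ʷ p q)

  ∈-walk-triples-++ʷ⁻ : ∀ {ℓ₁ ℓ₂ x y z j} (p : Walk ℓ₁ x y) (q : Walk ℓ₂ y z) →
                        j ∈ walk-triples (p ++ʷ q) → j ∈ walk-triples p ⊎ j ∈ walk-triples q
  ∈-walk-triples-++ʷ⁻ p q j∈ = ∈-++⁻ (walk-triples p) (subst (_ ∈_) (walk-triples-++ʷ p q) j∈)

  simple-++ʷ : ∀ {ℓ₁ ℓ₂ x y z} (p : Walk ℓ₁ x y) (q : Walk ℓ₂ y z) → Simple p → Simple q →
               (∀ {v} → v ∈ walk-vertices p → v ∈ walk-vertices q → v ≡ y) →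
               Disjoint (walk-triples p) (walk-triples q) → Simple (p ++ʷ q)
  simple-++ʷ []                         q _                    sq _    _   = sq
  simple-++ʷ (step {x = x} i x∈ y∈ p) q (x∉p , i∉p , sp) sq meet p#q =
    x∉p++q , i∉p++q , simple-++ʷ p q sp sq (meet ∘ there) (p#q ∘ Product.map₁ there)
    where
    x∉p++q : x ∉ walk-vertices (p ++ʷ q)
    x∉p++q x∈′ with ∈-++ʷ⁻ p q x∈′
    ... | inj₁ x∈p = x∉p x∈p
    ... | inj₂ x∈q with meet (here refl) x∈q
    ...   | refl = x∉p (end∈ p)
    i∉p++q : i ∉ walk-triples (p ++ʷ q)
    i∉p++q i∈ with ∈-walk-triples-++ʷ⁻ p q i∈
    ... | inj₁ i∈p = i∉p i∈p
    ... | inj₂ i∈q = p#q (here refl , i∈q)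

  record _≼_ {p r} (P : Tree p) (T : Tree r) : Set where
    field
      vertices⊆ : ∀ {v} → v ∈ᵀ P → v ∈ᵀ T
      triples⊆  : ∀ {j} → j ∈ triples P → j ∈ triples T

  record PathIn {r} (T : Tree r) (x y : V) : Set where
    constructor path
    field
      {len}  : ℕ
      walk   : Walk len x y
      simple : Simple walk
      vertices⊆ : ∀ {v} → v ∈ walk-vertices walk → v ∈ᵀ T
      triples⊆  : ∀ {j} → j ∈ walk-triples walk → j ∈ triples T

  widen : ∀ {p r x y} {P : Tree p} {T : Tree r} → P ≼ T → PathIn P x y → PathIn T x y
  widen P≼T (path p sp v⊆ t⊆) = path p sp (_≼_.vertices⊆ P≼T ∘ v⊆) (_≼_.triples⊆ P≼T ∘ t⊆)

  join : ∀ {r p p′ x a b y i} {T : Tree r} {P : Tree p} {Q : Tree p′} →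
         PathIn P x a → PathIn Q b y → a ∈ₛ Δ H i → b ∈ₛ Δ H i → P # Q → i ∉ triples P → i ∉ triples Q →
         P ≼ T → Q ≼ T → i ∈ triples T → PathIn T x y
  join {a = a} {y = y} {i = i} {T = T} {P} {Q} (path p sp v⊆P t⊆P) (path q sq v⊆Q t⊆Q) a∈ b∈ P#Q i∉P i∉Q P≼T Q≼T i∈T =
    path (p ++ʷ q′) (simple-++ʷ p q′ sp (a∉q , i∉Q ∘ t⊆Q , sq) meet p#q′) vertices⊆ triples⊆
    where
    q′ : Walk _ a y
    q′ = step i a∈ b∈ q
    a∉q : a ∉ walk-vertices q
    a∉q a∈q = P#Q (v⊆P (end∈ p)) (v⊆Q a∈q)
    meet : ∀ {v} → v ∈ walk-vertices p → v ∈ walk-vertices q′ → v ≡ a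
    meet _   (here v≡a)  = v≡a
    meet v∈p (there v∈q) = ⊥-elim (P#Q (v⊆P v∈p) (v⊆Q v∈q))
    p#q′ : Disjoint (walk-triples p) (walk-triples q′)
    p#q′ (j∈p , here refl) = i∉P (t⊆P j∈p)
    p#q′ (j∈p , there j∈q) = #⇒triples-disjoint P Q P#Q (t⊆P j∈p , t⊆Q j∈q)
    vertices⊆ : ∀ {v} → v ∈ walk-vertices (p ++ʷ q′) → v ∈ᵀ T
    vertices⊆ v∈ with ∈-++ʷ⁻ p q′ v∈
    ... | inj₁ v∈p         = _≼_.vertices⊆ P≼T (v⊆P v∈p)
    ... | inj₂ (here refl) = _≼_.vertices⊆ P≼T (v⊆P (end∈ p))
    ... | inj₂ (there v∈q) = _≼_.vertices⊆ Q≼T (v⊆Q v∈q)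
    triples⊆ : ∀ {j} → j ∈ walk-triples (p ++ʷ q′) → j ∈ triples T
    triples⊆ j∈ with ∈-walk-triples-++ʷ⁻ p q′ j∈
    ... | inj₁ j∈p         = _≼_.triples⊆ P≼T (t⊆P j∈p)
    ... | inj₂ (here refl) = i∈T
    ... | inj₂ (there j∈q) = _≼_.triples⊆ Q≼T (t⊆Q j∈q)

  route : ∀ {r x y} (T : Tree r) → Valid T → x ∈ᵀ T → y ∈ᵀ T → PathIn T x y
  route (leaf r) _ leaf leaf = path [] tt (λ { (here refl) → leaf }) (λ ())
  route {x = x} {y} T@(node {i = i} t A B C) (vA , vB , vC , A#B , A#C , B#C) x∈ y∈ = go x∈ y∈
    where
    A≼ : A ≼ T
    A≼ = record { vertices⊆ = in₁ ; triples⊆ = ∈-triples₁ t A B C }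
    B≼ : B ≼ T
    B≼ = record { vertices⊆ = in₂ ; triples⊆ = ∈-triples₂ t A B C }
    C≼ : C ≼ T
    C≼ = record { vertices⊆ = in₃ ; triples⊆ = ∈-triples₃ t A B C }
    i∈T : i ∈ triples T
    i∈T = ∈-triplesᵗ t A B C
    i∉A : i ∉ triples A
    i∉A i∈A = A#C (triple⊆vertices A i∈A (∋a t)) (root∈ C)
    i∉B : i ∉ triples B
    i∉B i∈B = B#C (triple⊆vertices B i∈B (∋a t)) (root∈ C)
    i∉C : i ∉ triples C
    i∉C i∈C = A#C (root∈ A) (triple⊆vertices C i∈C (∋b t))
    go : x ∈ᵀ T → y ∈ᵀ T → PathIn T x y
    go (in₁ x∈) (in₁ y∈) = widen A≼ (route A vA x∈ y∈)
    go (in₂ x∈) (in₂ y∈) = widen B≼ (route B vB x∈ y∈)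
    go (in₃ x∈) (in₃ y∈) = widen C≼ (route C vC x∈ y∈)
    go (in₁ x∈) (in₂ y∈) =
      join (route A vA x∈ (root∈ A)) (route B vB (root∈ B) y∈) (∋b t) (∋c t) A#B i∉A i∉B A≼ B≼ i∈T
    go (in₁ x∈) (in₃ y∈) =
      join (route A vA x∈ (root∈ A)) (route C vC (root∈ C) y∈) (∋b t) (∋a t) A#C i∉A i∉C A≼ C≼ i∈T
    go (in₂ x∈) (in₁ y∈) =
      join (route B vB x∈ (root∈ B)) (route A vA (root∈ A) y∈) (∋c t) (∋b t) (#-sym A#B) i∉B i∉A B≼ A≼ i∈T
    go (in₂ x∈) (in₃ y∈) =
      join (route B vB x∈ (root∈ B)) (route C vC (root∈ C) y∈) (∋c t) (∋a t) B#C i∉B i∉C B≼ C≼ i∈T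
    go (in₃ x∈) (in₁ y∈) =
      join (route C vC x∈ (root∈ C)) (route A vA (root∈ A) y∈) (∋a t) (∋b t) (#-sym A#C) i∉C i∉A C≼ A≼ i∈T
    go (in₃ x∈) (in₂ y∈) =
      join (route C vC x∈ (root∈ C)) (route B vB (root∈ B) y∈) (∋a t) (∋c t) (#-sym B#C) i∉C i∉B C≼ B≼ i∈T

  vertexAt : ∀ {ℓ x y} → Walk ℓ x y → Fin (suc ℓ) → V
  vertexAt ([] {x})               _       = x
  vertexAt (step {x = x} _ _ _ p) zero    = x
  vertexAt (step _ _ _ p)         (suc k) = vertexAt p k

  tripleAt : ∀ {ℓ x y} → Walk ℓ x y → Fin ℓ → Tr
  tripleAt (step i _ _ p) zero    = i
  tripleAt (step _ _ _ p) (suc k) = tripleAt p k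

  vertexAt-first : ∀ {ℓ x y} (p : Walk ℓ x y) → vertexAt p zero ≡ x
  vertexAt-first []             = refl
  vertexAt-first (step _ _ _ p) = refl

  vertexAt-last : ∀ {ℓ x y} (p : Walk ℓ x y) → vertexAt p (fromℕ ℓ) ≡ y
  vertexAt-last []             = refl
  vertexAt-last (step _ _ _ p) = vertexAt-last p

  vertexAt-left : ∀ {ℓ x y} (p : Walk ℓ x y) → ∀ k → vertexAt p (inject₁ k) ∈ₛ Δ H (tripleAt p k)
  vertexAt-left (step _ x∈ _ p) zero    = x∈
  vertexAt-left (step _ _  _ p) (suc k) = vertexAt-left p k

  vertexAt-right : ∀ {ℓ x y} (p : Walk ℓ x y) → ∀ k → vertexAt p (suc k) ∈ₛ Δ H (tripleAt p k)
  vertexAt-right (step i _ y∈ p) zero    = subst (_∈ₛ Δ H i) (sym (vertexAt-first p)) y∈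
  vertexAt-right (step _ _ _  p) (suc k) = vertexAt-right p k

  vertexAt-∈ : ∀ {ℓ x y} (p : Walk ℓ x y) → ∀ k → vertexAt p k ∈ walk-vertices p
  vertexAt-∈ []             _       = here refl
  vertexAt-∈ (step _ _ _ p) zero    = here refl
  vertexAt-∈ (step _ _ _ p) (suc k) = there (vertexAt-∈ p k)

  tripleAt-∈ : ∀ {ℓ x y} (p : Walk ℓ x y) → ∀ k → tripleAt p k ∈ walk-triples p
  tripleAt-∈ (step _ _ _ p) zero    = here refl
  tripleAt-∈ (step _ _ _ p) (suc k) = there (tripleAt-∈ p k)

  vertexAt-injective : ∀ {ℓ x y} (p : Walk ℓ x y) → Simple p → Injective _≡_ _≡_ (vertexAt p)
  vertexAt-injective []             _             {zero}  {zero}  _  = refl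
  vertexAt-injective (step _ _ _ p) _             {zero}  {zero}  _  = refl
  vertexAt-injective (step _ _ _ p) (x∉ , _ , _)  {zero}  {suc k} eq = ⊥-elim (x∉ (subst (_∈ _) (sym eq) (vertexAt-∈ p k)))
  vertexAt-injective (step _ _ _ p) (x∉ , _ , _)  {suc k} {zero}  eq = ⊥-elim (x∉ (subst (_∈ _) eq (vertexAt-∈ p k)))
  vertexAt-injective (step _ _ _ p) (_ , _ , sp)  {suc k} {suc k′} eq = cong suc (vertexAt-injective p sp eq)

  tripleAt-injective : ∀ {ℓ x y} (p : Walk ℓ x y) → Simple p → Injective _≡_ _≡_ (tripleAt p)
  tripleAt-injective (step _ _ _ p) _             {zero}  {zero}   _  = refl
  tripleAt-injective (step _ _ _ p) (_ , i∉ , _)  {zero}  {suc k}  eq = ⊥-elim (i∉ (subst (_∈ _) (sym eq) (tripleAt-∈ p k)))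
  tripleAt-injective (step _ _ _ p) (_ , i∉ , _)  {suc k} {zero}   eq = ⊥-elim (i∉ (subst (_∈ _) eq (tripleAt-∈ p k)))
  tripleAt-injective (step _ _ _ p) (_ , _ , sp)  {suc k} {suc k′} eq = cong suc (tripleAt-injective p sp eq)

  toPath : ∀ {r x y} {T : Tree r} → PathIn T x y → Path H (fromList (triples T)) x y
  toPath {T = T} (path p sp _ triples⊆) = record
    { walk  = record
      { a      = vertexAt p
      ; t      = tripleAt p
      ; t-inj  = tripleAt-injective p sp
      ; t-in-T = λ k → ∈-fromList⁺ (triples⊆ (tripleAt-∈ p k))
      ; left   = vertexAt-left p
      ; right  = vertexAt-right p }
    ; a-inj = vertexAt-injective p sp
    ; start = vertexAt-first p
    ; end   = vertexAt-last p }

  first-triple : ∀ {r x y} {T : Tree r} → PathIn T x y → x ≢ y → ∃[ j ] j ∈ triples T × x ∈ₛ Δ H j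
  first-triple (path []                 _ _ _)        x≢x = ⊥-elim (x≢x refl)
  first-triple (path (step i x∈ _ _)  _ _ triples⊆) _   = i , triples⊆ (here refl) , x∈

  -- Acyclicity

  OnSome : List Tr → V → Set
  OnSome ts x = ∃[ j ] j ∈ ts × x ∈ₛ Δ H j

  MeetsAtMostOnce : Tr → (V → Set) → Set
  MeetsAtMostOnce i P = ∀ {x x′} → x ∈ₛ Δ H i → x′ ∈ₛ Δ H i → P x → P x′ → x ≡ x′

  data Peelable (S : V → Set) : List Tr → Set where
    []  : Peelable S []
    _∷_ : ∀ {i ts} → MeetsAtMostOnce i (λ x → S x ⊎ OnSome ts x) → Peelable S ts → Peelable S (i ∷ ts)

  peelable-++ : ∀ {S S′ : V → Set} {xs ys} → Peelable S′ xs → Peelable S ys →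
                (∀ {j x} → j ∈ xs → x ∈ₛ Δ H j → S x ⊎ OnSome ys x → S′ x) → Peelable S (xs ++ ys)
  peelable-++ []                          peel-ys _    = peel-ys
  peelable-++ {S} {S′} {j ∷ xs} {ys} (once ∷ peel-xs) peel-ys into = once′ ∷ peelable-++ peel-xs peel-ys (into ∘ there)
    where
    shift : ∀ {x} → x ∈ₛ Δ H j → S x ⊎ OnSome (xs ++ ys) x → S′ x ⊎ OnSome xs x
    shift x∈ (inj₁ s) = inj₁ (into (here refl) x∈ (inj₁ s))
    shift x∈ (inj₂ (k , k∈ , x∈k)) with ∈-++⁻ xs k∈
    ... | inj₁ k∈xs = inj₂ (k , k∈xs , x∈k)
    ... | inj₂ k∈ys = inj₁ (into (here refl) x∈ (inj₂ (k , k∈ys , x∈k)))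
    once′ : MeetsAtMostOnce j (λ x → S x ⊎ OnSome (xs ++ ys) x)
    once′ x∈ x′∈ p p′ = once x∈ x′∈ (shift x∈ p) (shift x′∈ p′)

  tree-peelable : ∀ {r} (T : Tree r) → Valid T → Peelable (_≡ r) (triples T)
  tree-peelable (leaf r) _ = []
  tree-peelable {r} (node {y = y} {y′} {i} t A B C) (vA , vB , vC , A#B , A#C , B#C) =
    peelable-++ (tree-peelable A vA) (peelable-++ (tree-peelable B vB) (once ∷ tree-peelable C vC) intoB) intoA
    where
    onC : ∀ {x} → OnSome (triples C) x → x ∈ᵀ C
    onC (k , k∈ , x∈) = triple⊆vertices C k∈ x∈
    toRoot : ∀ {x} → x ∈ₛ Δ H i → x ≡ r ⊎ OnSome (triples C) x → x ≡ r
    toRoot _  (inj₁ x≡r) = x≡r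
    toRoot x∈ (inj₂ on) with only t x∈
    ... | inj₁ x≡r         = x≡r
    ... | inj₂ (inj₁ refl) = ⊥-elim (A#C (root∈ A) (onC on))
    ... | inj₂ (inj₂ refl) = ⊥-elim (B#C (root∈ B) (onC on))
    once : MeetsAtMostOnce i (λ x → x ≡ r ⊎ OnSome (triples C) x)
    once x∈ x′∈ p p′ = trans (toRoot x∈ p) (sym (toRoot x′∈ p′))
    intoB : ∀ {j x} → j ∈ triples B → x ∈ₛ Δ H j → x ≡ r ⊎ OnSome (i ∷ triples C) x → x ≡ y′
    intoB j∈ x∈ (inj₁ refl)                   = ⊥-elim (B#C (triple⊆vertices B j∈ x∈) (root∈ C))
    intoB j∈ x∈ (inj₂ (k , there k∈ , x∈k))  = ⊥-elim (B#C (triple⊆vertices B j∈ x∈) (onC (k , k∈ , x∈k)))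
    intoB j∈ x∈ (inj₂ (k , here refl , x∈k)) with only t x∈k
    ... | inj₁ refl        = ⊥-elim (B#C (triple⊆vertices B j∈ x∈) (root∈ C))
    ... | inj₂ (inj₁ refl) = ⊥-elim (A#B (root∈ A) (triple⊆vertices B j∈ x∈))
    ... | inj₂ (inj₂ x≡y′) = x≡y′
    intoA : ∀ {j x} → j ∈ triples A → x ∈ₛ Δ H j → x ≡ r ⊎ OnSome (triples B ++ i ∷ triples C) x → x ≡ y
    intoA j∈ x∈ (inj₁ refl) = ⊥-elim (A#C (triple⊆vertices A j∈ x∈) (root∈ C))
    intoA j∈ x∈ (inj₂ (k , k∈ , x∈k)) with ∈-++⁻ (triples B) k∈
    ... | inj₁ k∈B             = ⊥-elim (A#B (triple⊆vertices A j∈ x∈) (triple⊆vertices B k∈B x∈k))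
    ... | inj₂ (there k∈C)     = ⊥-elim (A#C (triple⊆vertices A j∈ x∈) (onC (k , k∈C , x∈k)))
    ... | inj₂ (here refl) with only t x∈k
    ...   | inj₁ refl        = ⊥-elim (A#C (triple⊆vertices A j∈ x∈) (root∈ C))
    ...   | inj₂ (inj₁ x≡y)  = x≡y
    ...   | inj₂ (inj₂ refl) = ⊥-elim (A#B (triple⊆vertices A j∈ x∈) (root∈ B))

  module _ {T : TripleSet H} {l : ℕ} (w : Linked H T (suc (suc l)))
           (closed : a w (fromℕ (suc (suc l))) ≡ a w zero) (a-inj : Injective _≡_ _≡_ (a w ∘ inject₁)) where

    private
      last≢zero : ∀ (k : Fin (suc (suc l))) → suc k ≡ fromℕ (suc (suc l)) → zero ≢ k
      last≢zero _ () refl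

    earlier : ∀ k → ∃[ k′ ] k′ ≢ k × a w (inject₁ k) ∈ₛ Δ H (t w k′)
    earlier zero    = fromℕ (suc l) , (λ ()) , subst (_∈ₛ Δ H (t w (fromℕ (suc l)))) closed (right w (fromℕ (suc l)))
    earlier (suc k) = inject₁ k , inject₁≢suc k , right w (inject₁ k)

    later : ∀ k → ∃[ k′ ] k′ ≢ k × a w (suc k) ∈ₛ Δ H (t w k′)
    later k with suc-inject₁⁻¹ k
    ... | inj₁ (k′ , eq) = k′ , (λ { refl → inject₁≢suc k eq }) , subst (λ v → a w v ∈ₛ Δ H (t w k′)) eq (left w k′)
    ... | inj₂ eq        = zero , last≢zero k eq , subst (_∈ₛ Δ H (t w zero)) (sym (trans (cong (a w) eq) closed)) (left w zero)

    ends-distinct : ∀ k → a w (inject₁ k) ≢ a w (suc k)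
    ends-distinct k eq with suc-inject₁⁻¹ k
    ... | inj₁ (k′ , eq′) with a-inj {k} {k′} (trans eq (cong (a w) (sym eq′)))
    ...   | refl = inject₁≢suc k eq′
    ends-distinct k eq | inj₂ eq′ = last≢zero k eq′ (sym (a-inj {k} {zero} (trans eq (trans (cong (a w) eq′) closed))))

    cycle-not-peelable : ∀ {S ts} → Peelable S ts → (∀ k → t w k ∈ ts) → ⊥
    cycle-not-peelable []               ∈ts with ∈ts zero
    ... | ()
    cycle-not-peelable {ts = i ∷ ts} (once ∷ peel) ∈ts with Fin.any? (λ k → t w k ≟ᶠ i)
    ... | no ∄k = cycle-not-peelable peel λ k → tail (∈ts k) (λ eq → ∄k (k , eq))
      where
      tail : ∀ {j} → j ∈ i ∷ ts → j ≢ i → j ∈ ts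
      tail (here j≡i) j≢i = ⊥-elim (j≢i j≡i)
      tail (there j∈) _   = j∈
    ... | yes (k , tk≡i) = ends-distinct k (once (subst (λ j → _ ∈ₛ Δ H j) tk≡i (left w k))
                                                  (subst (λ j → _ ∈ₛ Δ H j) tk≡i (right w k))
                                                  (inj₂ (on-rest (earlier k))) (inj₂ (on-rest (later k))))
      where
      on-rest : ∀ {x} → ∃[ k′ ] k′ ≢ k × x ∈ₛ Δ H (t w k′) → OnSome ts x
      on-rest (k′ , k′≢k , x∈) with ∈ts k′
      ... | here tk′≡i = ⊥-elim (k′≢k (t-inj w (trans tk′≡i (sym tk≡i))))
      ... | there tk′∈ = t w k′ , tk′∈ , x∈

  peelable⇒acyclic : ∀ {S ts} {T : TripleSet H} → Peelable S ts → (∀ {j} → j ∈ₛ T → j ∈ ts) → ¬ Cycle H T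
  peelable⇒acyclic peel T⊆ts c = go (Cycle.ℓ≥2 c) (Cycle.walk c) (Cycle.closed c) (Cycle.a-inj c)
    where
    go : ∀ {ℓ} → 2 ≤ ℓ → (w : Linked H _ ℓ) → a w (fromℕ ℓ) ≡ a w zero → Injective _≡_ _≡_ (a w ∘ inject₁) → ⊥
    go (s≤s (s≤s z≤n)) w closed a-inj = cycle-not-peelable w closed a-inj peel (λ k → T⊆ts (t-in-T w k))

  -- Spanning trees

  spanning-tree : (S : Spanning) → (∀ v → ∃[ v′ ] v ≢ v′) → IsSpanningTree H (fromList (triples (Spanning.tree S)))
  spanning-tree S other = record
    { acyclic   = peelable⇒acyclic (tree-peelable tree valid) (∈-fromList⁻ (triples tree))
    ; covers    = covers
    ; connected = λ x y → toPath (route tree valid (spans x) (spans y)) }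
    where
    open Spanning S
    covers : ∀ v → ∃[ j ] j ∈ₛ fromList (triples tree) × v ∈ₛ Δ H j
    covers v with other v
    ... | v′ , v≢v′ with first-triple (route tree valid (spans v) (spans v′)) v≢v′
    ...   | j , j∈ , v∈ = j , ∈-fromList⁺ j∈ , v∈

theorem3p3 : ∀ (n : ℕ) (H : ThreeGraph n) → 3 ≤ n → Odd n → PairCovering H →
    ∃[ T ] IsSpanningTree H T
theorem3p3 n@(suc (suc (suc _))) H (s≤s (s≤s (s≤s z≤n))) odd covering =
  fromList (triples H (Spanning.tree S)) , spanning-tree H S other
  where
  open Growth H covering odd
  S : Spanning H
  S = grow n (leaf zero) tt (≤-reflexive (sym (+-identityʳ n)))
  other : ∀ (v : Fin n) → ∃[ v′ ] v ≢ v′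
  other zero    = suc zero , λ ()
  other (suc _) = zero , λ ()
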